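{- Let $m\ge 0$ and $\mathbf u=(u_0,\dots,u_m)$. For $j\in\mathbb{Z}$ let $S_j=S_j(z,\mathbf u)=\sum_B z^{|B|}\prod_{\ell=0}^m u_\ell^{N_{j,\ell}(B)}$, the sum over all naturally embedded ternary trees $B$, where $|B|$ is the number of internal nodes and $N_{j,\ell}(B)$ is the number of internal nodes with label in $\{j-\ell,j+\ell\}$. Then $S_j=S_{ -j}$ for all $j\in\mathbb{Z}$, and the $S_j$ are determined by $$S_j=1+zS_{j-1}S_jS_{j+1}\ (j\ge m+1),\qquad S_j=1+u_jzS_{j-1}S_jS_{j+1}\ (0\le j\le m),$$ $$S_0=1+u_0zS_{ -1}S_0S_1=1+u_0zS_0S_1^2.$$
   Context: A ternary tree is either an external node or an internal node with three ordered subtrees (left, center, right). In the natural embedding the root has label $0$ and the left, center, right children of a node with label $j$ have labels $j-1,j,j+1$. -}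

module Defs where

open import Data.Bool using (Bool; true; false; _∧_; if_then_else_)
open import Data.Nat using (ℕ; zero; suc; _+_; _*_; _∸_; _≡ᵇ_; _<_)
open import Data.Integer using (ℤ; +_; -_; ∣_∣; 1ℤ) renaming (_+_ to _+ℤ_; _-_ to _-ℤ_)
open import Data.Fin using (Fin; toℕ)
open import Data.Vec using (Vec; []; _∷_; tabulate; replicate; zipWith; lookup; _[_]≔_)
open import Data.List using (List; []; _∷_; map; concatMap; length; filterᵇ; upTo)
open import Data.Nat.ListAction using (sum)
open import Data.Product using (_×_)
open import Relation.Binary.PropositionalEquality using (_≡_)

data Tree : Set where
  leaf : Tree
  node : Tree → Tree → Tree → Tree

size : Tree → ℕ
size leaf = 0
size (node a b c) = suc (size a + size b + size c)

-- cnt k j ℓ B : number of internal nodes of B (whose root carries label k in the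
-- natural embedding) with label in {j-ℓ, j+ℓ}, i.e. with |label - j| = ℓ.
cnt : ℤ → ℤ → ℕ → Tree → ℕ
cnt k j ℓ leaf = 0
cnt k j ℓ (node a b c) =
  (if ∣ k -ℤ j ∣ ≡ᵇ ℓ then 1 else 0)
  + cnt (k -ℤ 1ℤ) j ℓ a + cnt k j ℓ b + cnt (k +ℤ 1ℤ) j ℓ c

N : ℤ → ℕ → Tree → ℕ
N j ℓ B = cnt (+ 0) j ℓ B

-- all trees of height ≤ h (each exactly once); a tree with n internal nodes has height ≤ n
treesH : ℕ → List Tree
treesH zero = leaf ∷ []
treesH (suc h) = leaf ∷ concatMap (λ x → concatMap (λ y → map (λ w → node x y w) ts) ts) ts
  where ts = treesH h

Exp : ℕ → Set
Exp m = Vec ℕ (suc m)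

vecEqᵇ : ∀ {k} → Vec ℕ k → Vec ℕ k → Bool
vecEqᵇ [] [] = true
vecEqᵇ (x ∷ xs) (y ∷ ys) = (x ≡ᵇ y) ∧ vecEqᵇ xs ys

-- Formal power series in z with coefficients in ℕ[u_0,…,u_m]:
-- Ser m n e = coefficient of z^n u^e.
Ser : ℕ → Set
Ser m = ℕ → Exp m → ℕ

_≈_ : ∀ {m} → Ser m → Ser m → Set
f ≈ g = ∀ n e → f n e ≡ g n e
infix 4 _≈_

mono : ∀ {m} → ℕ → Exp m → Ser m
mono n0 e0 n e = if (n ≡ᵇ n0) ∧ vecEqᵇ e e0 then 1 else 0

one : ∀ {m} → Ser m
one = mono 0 (replicate _ 0)

z : ∀ {m} → Ser m
z = mono 1 (replicate _ 0)

u : ∀ {m} → Fin (suc m) → Ser m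
u ℓ = mono 0 (replicate _ 0 [ ℓ ]≔ 1)

_⊕_ : ∀ {m} → Ser m → Ser m → Ser m
(f ⊕ g) n e = f n e + g n e

below : ∀ {k} → Vec ℕ k → List (Vec ℕ k)
below [] = [] ∷ []
below (x ∷ xs) = concatMap (λ a → map (a ∷_) (below xs)) (upTo (suc x))

_⊗_ : ∀ {m} → Ser m → Ser m → Ser m
(f ⊗ g) n e = sum (concatMap (λ n1 → map (λ e1 → f n1 e1 * g (n ∸ n1) (zipWith _∸_ e e1)) (below e)) (upTo (suc n)))

infixl 7 _⊗_
infixl 6 _⊕_

-- S_j(z,u) = Σ_B z^{|B|} Π_ℓ u_ℓ^{N_{j,ℓ}(B)}, coefficientwise:
-- coefficient of z^n u^e = number of trees B with |B| = n and N_{j,ℓ}(B) = e_ℓ for all ℓ ≤ m.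
Nvec : (m : ℕ) → ℤ → Tree → Exp m
Nvec m j B = tabulate (λ ℓ → N j (toℕ ℓ) B)

S : (m : ℕ) → ℤ → Ser m
S m j n e = length (filterᵇ (λ B → (size B ≡ᵇ n) ∧ vecEqᵇ (Nvec m j B) e) (treesH n))

System : (m : ℕ) → (ℤ → Ser m) → Set
System m T =
  (∀ (j : ℤ) → T j ≈ T (- j)) ×
  (∀ (j : ℕ) → m < j →
     T (+ j) ≈ one ⊕ z ⊗ T (+ j -ℤ 1ℤ) ⊗ T (+ j) ⊗ T (+ j +ℤ 1ℤ)) ×
  (∀ (j : Fin (suc m)) →
     T (+ toℕ j) ≈ one ⊕ u j ⊗ z ⊗ T (+ toℕ j -ℤ 1ℤ) ⊗ T (+ toℕ j) ⊗ T (+ toℕ j +ℤ 1ℤ))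

-- In the natural embedding the subtrees
-- are rooted at labels -1, 0 and 1, so by translating labels their nodes, counted from j, behave
-- like those of trees rooted at 0 counted from j + 1, j and j - 1; the root itself lies at distance
-- |j| from j and contributes z u_j (just z when j > m).  Summing over trees gives the functional
-- equation for S_j.  Reflecting a tree (exchanging its left and right subtrees, recursively) negates
-- all labels, whence S_j = S_{-j} and the second form of the equation at j = 0.  The system has only
-- one solution because each product on its right-hand side is divisible by z: the coefficients of
-- z^(n+1) of a solution are determined by its coefficients of degree at most n.
--
-- Up to degree N, S_j is the series of the finite list of
-- monomials z^|B| u^N_j(B), B ranging over the trees of height at most N, and the Cauchy product of
-- the series of two lists is the series of the list of pairwise products.  Products of the S_j are
-- computed, and their middle factors exchanged, through these finite lists.

module Submission where

open import Defs

open import Algebra.Properties.CommutativeSemigroup using (interchange; xy∙z≈xz∙y)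
open import Data.Bool using (Bool; true; false; _∧_; T; if_then_else_)
open import Data.Fin using (Fin; zero; suc; toℕ; fromℕ<)
open import Data.Fin.Properties using (toℕ<n; toℕ-fromℕ<)
open import Data.Integer using (ℤ; -[1+_]; -_; ∣_∣; 1ℤ) renaming (+_ to ⁺_; _+_ to _+ℤ_; _-_ to _-ℤ_)
import Data.Integer.Properties as ℤ
open import Data.Integer.Tactic.RingSolver using (solve-∀)
open import Data.List using (List; []; _∷_; map; concatMap; length; filterᵇ; upTo; applyUpTo; _++_)
open import Data.List.Properties using (map-++; map-applyUpTo)
open import Data.List.Relation.Unary.All using (All; []; _∷_)
open import Data.List.Relation.Unary.All.Properties using (all-upTo)
open import Data.Nat using (ℕ; zero; suc; _+_; _*_; _∸_; _≡ᵇ_; _<ᵇ_; _<_; _≤_; _≤?_; z≤n; s≤s)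
open import Data.Nat.ListAction using (sum)
open import Data.Nat.ListAction.Properties using (sum-++)
open import Data.Nat.Properties
open import Data.Nat.Tactic.RingSolver using () renaming (solve-∀ to solve-∀ℕ)
open import Data.Product using (_×_; _,_; proj₁; proj₂)
open import Data.Sum using (inj₁; inj₂)
open import Data.Vec using (Vec; []; _∷_; zipWith; tabulate; replicate; _[_]≔_)
open import Data.Vec.Properties using (tabulate-cong; zipWith-identityʳ)
open import Relation.Binary.PropositionalEquality
open import Relation.Nullary using (yes; no; contradiction)

open ≡-Reasoning

private
  +-interchange = interchange +-commutativeSemigroup
  *-interchange = interchange *-commutativeSemigroup

∑ : {A : Set} → List A → (A → ℕ) → ℕ
∑ L f = sum (map f L)

syntax ∑ L (λ x → f) = ∑[ x ∈ L ] f

module _ {A : Set} where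

  ∑-cong : (L : List A) {f g : A → ℕ} → (∀ x → f x ≡ g x) → ∑ L f ≡ ∑ L g
  ∑-cong []      f≗g = refl
  ∑-cong (x ∷ L) f≗g = cong₂ _+_ (f≗g x) (∑-cong L f≗g)

  ∑-cong-All : {P : A → Set} (L : List A) {f g : A → ℕ} →
               All P L → (∀ x → P x → f x ≡ g x) → ∑ L f ≡ ∑ L g
  ∑-cong-All []      []         f≗g = refl
  ∑-cong-All (x ∷ L) (px ∷ pxs) f≗g = cong₂ _+_ (f≗g x px) (∑-cong-All L pxs f≗g)

  ∑-++ : (L M : List A) (f : A → ℕ) → ∑ (L ++ M) f ≡ ∑ L f + ∑ M f
  ∑-++ L M f = trans (cong sum (map-++ f L M)) (sum-++ (map f L) (map f M))

  ∑-zero : (L : List A) → ∑[ x ∈ L ] 0 ≡ 0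
  ∑-zero []      = refl
  ∑-zero (x ∷ L) = ∑-zero L

  ∑-+ : (L : List A) (f g : A → ℕ) → ∑[ x ∈ L ] (f x + g x) ≡ ∑ L f + ∑ L g
  ∑-+ []      f g = refl
  ∑-+ (x ∷ L) f g =
    trans (cong (λ r → f x + g x + r) (∑-+ L f g)) (+-interchange (f x) (g x) (∑ L f) (∑ L g))

  ∑-*ˡ : (L : List A) (c : ℕ) (f : A → ℕ) → ∑[ x ∈ L ] (c * f x) ≡ c * ∑ L f
  ∑-*ˡ []      c f = sym (*-zeroʳ c)
  ∑-*ˡ (x ∷ L) c f =
    trans (cong (c * f x +_) (∑-*ˡ L c f)) (sym (*-distribˡ-+ c (f x) (∑ L f)))

  ∑-*ʳ : (L : List A) (c : ℕ) (f : A → ℕ) → ∑[ x ∈ L ] (f x * c) ≡ ∑ L f * c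
  ∑-*ʳ L c f = trans (∑-cong L (λ x → *-comm (f x) c)) (trans (∑-*ˡ L c f) (*-comm c (∑ L f)))

module _ {A B : Set} where

  ∑-map : (h : A → B) (L : List A) (f : B → ℕ) → ∑ (map h L) f ≡ ∑[ x ∈ L ] f (h x)
  ∑-map h []      f = refl
  ∑-map h (x ∷ L) f = cong (f (h x) +_) (∑-map h L f)

  ∑-concatMap : (g : A → List B) (L : List A) (f : B → ℕ) →
                ∑ (concatMap g L) f ≡ ∑[ x ∈ L ] ∑ (g x) f
  ∑-concatMap g []      f = refl
  ∑-concatMap g (x ∷ L) f =
    trans (∑-++ (g x) (concatMap g L) f) (cong (∑ (g x) f +_) (∑-concatMap g L f))

  ∑-comm : (L : List A) (M : List B) (f : A → B → ℕ) →
           ∑[ x ∈ L ] ∑[ y ∈ M ] f x y ≡ ∑[ y ∈ M ] ∑[ x ∈ L ] f x y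
  ∑-comm []      M f = sym (∑-zero M)
  ∑-comm (x ∷ L) M f =
    trans (cong (∑ M (f x) +_) (∑-comm L M f)) (sym (∑-+ M (f x) (λ y → ∑[ x′ ∈ L ] f x′ y)))

  ∑-*-∑ : (L : List A) (M : List B) (f : A → ℕ) (g : B → ℕ) →
          ∑[ x ∈ L ] ∑[ y ∈ M ] (f x * g y) ≡ ∑ L f * ∑ M g
  ∑-*-∑ L M f g = trans (∑-cong L (λ x → ∑-*ˡ M (f x) g)) (∑-*ʳ L (∑ M g) f)

sum-concatMap : {A : Set} (g : A → List ℕ) (L : List A) → sum (concatMap g L) ≡ ∑[ x ∈ L ] sum (g x)
sum-concatMap g []      = refl
sum-concatMap g (x ∷ L) = trans (sum-++ (g x) (concatMap g L)) (cong (sum (g x) +_) (sum-concatMap g L))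

∑-applyUpTo-suc : ∀ k (f : ℕ → ℕ) → ∑ (applyUpTo suc k) f ≡ ∑[ i ∈ upTo k ] f (suc i)
∑-applyUpTo-suc k f = trans (cong (λ L → ∑ L f) (sym (map-applyUpTo (λ i → i) suc k))) (∑-map suc (upTo k) f)

∑-reverse₃ : {A : Set} (L : List A) (f : A → A → A → ℕ) →
             ∑[ x ∈ L ] ∑[ y ∈ L ] ∑[ w ∈ L ] f x y w ≡ ∑[ w ∈ L ] ∑[ y ∈ L ] ∑[ x ∈ L ] f x y w
∑-reverse₃ L f = begin
  ∑[ x ∈ L ] ∑[ y ∈ L ] ∑[ w ∈ L ] f x y w ≡⟨ ∑-cong L (λ x → ∑-comm L L (f x)) ⟩
  ∑[ x ∈ L ] ∑[ w ∈ L ] ∑[ y ∈ L ] f x y w ≡⟨ ∑-comm L L (λ x w → ∑[ y ∈ L ] f x y w) ⟩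
  ∑[ w ∈ L ] ∑[ x ∈ L ] ∑[ y ∈ L ] f x y w ≡⟨ ∑-cong L (λ w → ∑-comm L L (λ x y → f x y w)) ⟩
  ∑[ w ∈ L ] ∑[ y ∈ L ] ∑[ x ∈ L ] f x y w ∎

∑∑-comm-∑∑ : {A B C D : Set} (K : List A) (L : List B) (M : List C) (N : List D)
             (f : A → B → C → D → ℕ) →
             ∑[ a ∈ K ] ∑[ b ∈ L ] ∑[ c ∈ M ] ∑[ d ∈ N ] f a b c d
             ≡ ∑[ c ∈ M ] ∑[ d ∈ N ] ∑[ a ∈ K ] ∑[ b ∈ L ] f a b c d
∑∑-comm-∑∑ K L M N f = begin
  ∑[ a ∈ K ] ∑[ b ∈ L ] ∑[ c ∈ M ] ∑[ d ∈ N ] f a b c d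
    ≡⟨ ∑-cong K (λ a → ∑-comm L M (λ b c → ∑[ d ∈ N ] f a b c d)) ⟩
  ∑[ a ∈ K ] ∑[ c ∈ M ] ∑[ b ∈ L ] ∑[ d ∈ N ] f a b c d
    ≡⟨ ∑-comm K M (λ a c → ∑[ b ∈ L ] ∑[ d ∈ N ] f a b c d) ⟩
  ∑[ c ∈ M ] ∑[ a ∈ K ] ∑[ b ∈ L ] ∑[ d ∈ N ] f a b c d
    ≡⟨ ∑-cong M (λ c → ∑-cong K (λ a → ∑-comm L N (λ b d → f a b c d))) ⟩
  ∑[ c ∈ M ] ∑[ a ∈ K ] ∑[ d ∈ N ] ∑[ b ∈ L ] f a b c d
    ≡⟨ ∑-cong M (λ c → ∑-comm K N (λ a d → ∑[ b ∈ L ] f a b c d)) ⟩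
  ∑[ c ∈ M ] ∑[ d ∈ N ] ∑[ a ∈ K ] ∑[ b ∈ L ] f a b c d ∎

⟦_⟧ : Bool → ℕ
⟦ b ⟧ = if b then 1 else 0

⟦∧⟧ : ∀ a b → ⟦ a ∧ b ⟧ ≡ ⟦ a ⟧ * ⟦ b ⟧
⟦∧⟧ true  b = sym (+-identityʳ ⟦ b ⟧)
⟦∧⟧ false b = refl

length-filterᵇ : {A : Set} (P : A → Bool) (L : List A) → length (filterᵇ P L) ≡ ∑[ x ∈ L ] ⟦ P x ⟧
length-filterᵇ P []      = refl
length-filterᵇ P (x ∷ L) with P x
... | true  = cong suc (length-filterᵇ P L)
... | false = length-filterᵇ P L

≡ᵇ-false : ∀ {m n} → m ≢ n → (m ≡ᵇ n) ≡ false
≡ᵇ-false {m} {n} m≢n with m ≡ᵇ n in eq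
... | false = refl
... | true  = contradiction (≡ᵇ⇒≡ m n (subst T (sym eq) _)) m≢n

≡ᵇ-sym : ∀ m n → (m ≡ᵇ n) ≡ (n ≡ᵇ m)
≡ᵇ-sym zero    zero    = refl
≡ᵇ-sym zero    (suc n) = refl
≡ᵇ-sym (suc m) zero    = refl
≡ᵇ-sym (suc m) (suc n) = ≡ᵇ-sym m n

vecEqᵇ-sym : ∀ {k} (v w : Vec ℕ k) → vecEqᵇ v w ≡ vecEqᵇ w v
vecEqᵇ-sym []      []      = refl
vecEqᵇ-sym (x ∷ v) (y ∷ w) = cong₂ _∧_ (≡ᵇ-sym x y) (vecEqᵇ-sym v w)

vecLeqᵇ : ∀ {k} → Vec ℕ k → Vec ℕ k → Bool
vecLeqᵇ []      []      = true
vecLeqᵇ (v ∷ vs) (x ∷ xs) = (v <ᵇ suc x) ∧ vecLeqᵇ vs xs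

∑-upTo-indicator : ∀ k s (g : ℕ → ℕ) → ∑[ i ∈ upTo k ] (⟦ i ≡ᵇ s ⟧ * g i) ≡ ⟦ s <ᵇ k ⟧ * g s
∑-upTo-indicator zero    s       g = refl
∑-upTo-indicator (suc k) zero    g =
  trans (cong (g 0 + 0 +_) (trans (∑-applyUpTo-suc k _) (∑-zero (upTo k)))) (+-identityʳ _)
∑-upTo-indicator (suc k) (suc s) g =
  trans (∑-applyUpTo-suc k _) (∑-upTo-indicator k s (λ i → g (suc i)))

∑-below-indicator : ∀ {k} (e v : Vec ℕ k) (g : Vec ℕ k → ℕ) →
                    ∑[ e₁ ∈ below e ] (⟦ vecEqᵇ e₁ v ⟧ * g e₁) ≡ ⟦ vecLeqᵇ v e ⟧ * g v
∑-below-indicator []       []       g = +-identityʳ _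
∑-below-indicator (x ∷ xs) (v ∷ vs) g = begin
  ∑ (below (x ∷ xs)) F
    ≡⟨ ∑-concatMap (λ a → map (a ∷_) (below xs)) (upTo (suc x)) F ⟩
  ∑[ a ∈ upTo (suc x) ] ∑ (map (a ∷_) (below xs)) F
    ≡⟨ ∑-cong (upTo (suc x)) (λ a → trans (∑-map (a ∷_) (below xs) F) (inner a)) ⟩
  ∑[ a ∈ upTo (suc x) ] (⟦ a ≡ᵇ v ⟧ * (⟦ vecLeqᵇ vs xs ⟧ * g (a ∷ vs)))
    ≡⟨ ∑-upTo-indicator (suc x) v (λ a → ⟦ vecLeqᵇ vs xs ⟧ * g (a ∷ vs)) ⟩
  ⟦ v <ᵇ suc x ⟧ * (⟦ vecLeqᵇ vs xs ⟧ * g (v ∷ vs))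
    ≡⟨ sym (*-assoc ⟦ v <ᵇ suc x ⟧ _ _) ⟩
  ⟦ v <ᵇ suc x ⟧ * ⟦ vecLeqᵇ vs xs ⟧ * g (v ∷ vs)
    ≡⟨ cong (_* g (v ∷ vs)) (sym (⟦∧⟧ (v <ᵇ suc x) (vecLeqᵇ vs xs))) ⟩
  ⟦ vecLeqᵇ (v ∷ vs) (x ∷ xs) ⟧ * g (v ∷ vs) ∎
  where
  F : Vec ℕ _ → ℕ
  F e₁ = ⟦ vecEqᵇ e₁ (v ∷ vs) ⟧ * g e₁
  inner : ∀ a → ∑[ r ∈ below xs ] F (a ∷ r) ≡ ⟦ a ≡ᵇ v ⟧ * (⟦ vecLeqᵇ vs xs ⟧ * g (a ∷ vs))
  inner a = begin
    ∑[ r ∈ below xs ] F (a ∷ r)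
      ≡⟨ ∑-cong (below xs) (λ r → trans (cong (_* g (a ∷ r)) (⟦∧⟧ (a ≡ᵇ v) (vecEqᵇ r vs)))
                                        (*-assoc ⟦ a ≡ᵇ v ⟧ _ _)) ⟩
    ∑[ r ∈ below xs ] (⟦ a ≡ᵇ v ⟧ * (⟦ vecEqᵇ r vs ⟧ * g (a ∷ r)))
      ≡⟨ ∑-*ˡ (below xs) ⟦ a ≡ᵇ v ⟧ _ ⟩
    ⟦ a ≡ᵇ v ⟧ * ∑[ r ∈ below xs ] (⟦ vecEqᵇ r vs ⟧ * g (a ∷ r))
      ≡⟨ cong (⟦ a ≡ᵇ v ⟧ *_) (∑-below-indicator xs vs (λ r → g (a ∷ r))) ⟩
    ⟦ a ≡ᵇ v ⟧ * (⟦ vecLeqᵇ vs xs ⟧ * g (a ∷ vs)) ∎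

∸-indicator : ∀ n s t → ⟦ s <ᵇ suc n ⟧ * ⟦ n ∸ s ≡ᵇ t ⟧ ≡ ⟦ n ≡ᵇ s + t ⟧
∸-indicator n       zero    t = +-identityʳ ⟦ n ≡ᵇ t ⟧
∸-indicator zero    (suc s) t = refl
∸-indicator (suc n) (suc s) t = ∸-indicator n s t

zipWith-∸-indicator : ∀ {k} (e v w : Vec ℕ k) →
  ⟦ vecLeqᵇ v e ⟧ * ⟦ vecEqᵇ (zipWith _∸_ e v) w ⟧ ≡ ⟦ vecEqᵇ e (zipWith _+_ v w) ⟧
zipWith-∸-indicator []      []      []      = refl
zipWith-∸-indicator (x ∷ e) (s ∷ v) (t ∷ w) = begin
  ⟦ (s <ᵇ suc x) ∧ vecLeqᵇ v e ⟧ * ⟦ (x ∸ s ≡ᵇ t) ∧ vecEqᵇ (zipWith _∸_ e v) w ⟧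
    ≡⟨ cong₂ _*_ (⟦∧⟧ (s <ᵇ suc x) _) (⟦∧⟧ (x ∸ s ≡ᵇ t) _) ⟩
  ⟦ s <ᵇ suc x ⟧ * ⟦ vecLeqᵇ v e ⟧ * (⟦ x ∸ s ≡ᵇ t ⟧ * ⟦ vecEqᵇ (zipWith _∸_ e v) w ⟧)
    ≡⟨ *-interchange ⟦ s <ᵇ suc x ⟧ _ _ _ ⟩
  ⟦ s <ᵇ suc x ⟧ * ⟦ x ∸ s ≡ᵇ t ⟧ * (⟦ vecLeqᵇ v e ⟧ * ⟦ vecEqᵇ (zipWith _∸_ e v) w ⟧)
    ≡⟨ cong₂ _*_ (∸-indicator x s t) (zipWith-∸-indicator e v w) ⟩
  ⟦ x ≡ᵇ s + t ⟧ * ⟦ vecEqᵇ e (zipWith _+_ v w) ⟧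
    ≡⟨ sym (⟦∧⟧ (x ≡ᵇ s + t) _) ⟩
  ⟦ (x ≡ᵇ s + t) ∧ vecEqᵇ e (zipWith _+_ v w) ⟧ ∎

_+ᵛ_ : ∀ {k} → Vec ℕ k → Vec ℕ k → Vec ℕ k
_+ᵛ_ = zipWith _+_

infixl 6 _+ᵛ_

-- (n , e) stands for the monomial z^n u^e.
Mon : ℕ → Set
Mon m = ℕ × Exp m

_·_ : ∀ {m} → Mon m → Mon m → Mon m
(s , v) · (t , w) = s + t , v +ᵛ w

infixl 7 _·_

·-swapʳ : ∀ {m} (a b c : Mon m) → a · b · c ≡ a · c · b
·-swapʳ (s , v) (t , w) (r , x) = cong₂ _,_ (+-swapʳ s t r) (vec-swapʳ v w x)
  where
  +-swapʳ = xy∙z≈xz∙y +-commutativeSemigroup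
  vec-swapʳ : ∀ {k} (v w x : Vec ℕ k) → v +ᵛ w +ᵛ x ≡ v +ᵛ x +ᵛ w
  vec-swapʳ []      []      []      = refl
  vec-swapʳ (a ∷ v) (b ∷ w) (c ∷ x) = cong₂ _∷_ (+-swapʳ a b c) (vec-swapʳ v w x)

⟪_⟫ : ∀ {m} → Mon m → Ser m
⟪ s , v ⟫ = mono s v

gf : ∀ {m} → List (Mon m) → Ser m
gf L n e = ∑[ a ∈ L ] ⟪ a ⟫ n e

_⋆_ : ∀ {m} → List (Mon m) → List (Mon m) → List (Mon m)
L ⋆ M = concatMap (λ a → map (a ·_) M) L

infixl 7 _⋆_

∑-⋆ : ∀ {m} (L M : List (Mon m)) (f : Mon m → ℕ) → ∑ (L ⋆ M) f ≡ ∑[ a ∈ L ] ∑[ b ∈ M ] f (a · b)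
∑-⋆ L M f = trans (∑-concatMap (λ a → map (a ·_) M) L f) (∑-cong L (λ a → ∑-map (a ·_) M f))

module _ {m : ℕ} where

  ≈-refl : {f : Ser m} → f ≈ f
  ≈-refl n e = refl

  ≈-sym : {f g : Ser m} → f ≈ g → g ≈ f
  ≈-sym f≈g n e = sym (f≈g n e)

  ≈-trans : {f g h : Ser m} → f ≈ g → g ≈ h → f ≈ h
  ≈-trans f≈g g≈h n e = trans (f≈g n e) (g≈h n e)

  mono≈gf : (a : Mon m) → ⟪ a ⟫ ≈ gf (a ∷ [])
  mono≈gf a n e = sym (+-identityʳ _)

  ⊗-coeff : (f g : Ser m) (n : ℕ) (e : Exp m) →
            (f ⊗ g) n e ≡ ∑[ n₁ ∈ upTo (suc n) ] ∑[ e₁ ∈ below e ] (f n₁ e₁ * g (n ∸ n₁) (zipWith _∸_ e e₁))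
  ⊗-coeff f g n e =
    sum-concatMap (λ n₁ → map (λ e₁ → f n₁ e₁ * g (n ∸ n₁) (zipWith _∸_ e e₁)) (below e)) (upTo (suc n))

  mono-⊗ : (a b : Mon m) → ⟪ a ⟫ ⊗ ⟪ b ⟫ ≈ ⟪ a · b ⟫
  mono-⊗ (s , v) (t , w) n e = begin
    (mono s v ⊗ mono t w) n e
      ≡⟨ ⊗-coeff (mono s v) (mono t w) n e ⟩
    ∑[ n₁ ∈ U ] ∑[ e₁ ∈ below e ] (⟦ (n₁ ≡ᵇ s) ∧ vecEqᵇ e₁ v ⟧ * ⟦ (n ∸ n₁ ≡ᵇ t) ∧ vecEqᵇ (e ∸ᵛ e₁) w ⟧)
      ≡⟨ ∑-cong U (λ n₁ → ∑-cong (below e) (λ e₁ →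
           trans (cong₂ _*_ (⟦∧⟧ (n₁ ≡ᵇ s) _) (⟦∧⟧ (n ∸ n₁ ≡ᵇ t) _)) (*-interchange ⟦ n₁ ≡ᵇ s ⟧ _ _ _))) ⟩
    ∑[ n₁ ∈ U ] ∑[ e₁ ∈ below e ] (δ-degree n₁ * δ-exponent e₁)
      ≡⟨ ∑-*-∑ U (below e) δ-degree δ-exponent ⟩
    ∑ U δ-degree * ∑ (below e) δ-exponent
      ≡⟨ cong₂ _*_ (trans (∑-upTo-indicator (suc n) s (λ n₁ → ⟦ n ∸ n₁ ≡ᵇ t ⟧)) (∸-indicator n s t))
                   (trans (∑-below-indicator e v (λ e₁ → ⟦ vecEqᵇ (e ∸ᵛ e₁) w ⟧))
                          (zipWith-∸-indicator e v w)) ⟩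
    ⟦ n ≡ᵇ s + t ⟧ * ⟦ vecEqᵇ e (v +ᵛ w) ⟧
      ≡⟨ sym (⟦∧⟧ (n ≡ᵇ s + t) _) ⟩
    mono (s + t) (v +ᵛ w) n e ∎
    where
    U = upTo (suc n)
    _∸ᵛ_ = zipWith _∸_
    δ-degree : ℕ → ℕ
    δ-degree n₁ = ⟦ n₁ ≡ᵇ s ⟧ * ⟦ n ∸ n₁ ≡ᵇ t ⟧
    δ-exponent : Exp m → ℕ
    δ-exponent e₁ = ⟦ vecEqᵇ e₁ v ⟧ * ⟦ vecEqᵇ (e ∸ᵛ e₁) w ⟧

  gf-⊗ : (L M : List (Mon m)) → gf L ⊗ gf M ≈ gf (L ⋆ M)
  gf-⊗ L M n e = begin
    (gf L ⊗ gf M) n e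
      ≡⟨ ⊗-coeff (gf L) (gf M) n e ⟩
    ∑[ n₁ ∈ U ] ∑[ e₁ ∈ below e ] (gf L n₁ e₁ * gf M (n ∸ n₁) (zipWith _∸_ e e₁))
      ≡⟨ ∑-cong U (λ n₁ → ∑-cong (below e) (λ e₁ → sym (∑-*-∑ L M _ _))) ⟩
    ∑[ n₁ ∈ U ] ∑[ e₁ ∈ below e ] ∑[ a ∈ L ] ∑[ b ∈ M ] (⟪ a ⟫ n₁ e₁ * ⟪ b ⟫ (n ∸ n₁) (zipWith _∸_ e e₁))
      ≡⟨ ∑∑-comm-∑∑ U (below e) L M _ ⟩
    ∑[ a ∈ L ] ∑[ b ∈ M ] ∑[ n₁ ∈ U ] ∑[ e₁ ∈ below e ] (⟪ a ⟫ n₁ e₁ * ⟪ b ⟫ (n ∸ n₁) (zipWith _∸_ e e₁))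
      ≡⟨ ∑-cong L (λ a → ∑-cong M (λ b → trans (sym (⊗-coeff ⟪ a ⟫ ⟪ b ⟫ n e)) (mono-⊗ a b n e))) ⟩
    ∑[ a ∈ L ] ∑[ b ∈ M ] ⟪ a · b ⟫ n e
      ≡⟨ sym (∑-⋆ L M (λ c → ⟪ c ⟫ n e)) ⟩
    gf (L ⋆ M) n e ∎
    where U = upTo (suc n)

_≈[_]_ : ∀ {m} → Ser m → ℕ → Ser m → Set
f ≈[ n ] g = ∀ k → k ≤ n → ∀ e → f k e ≡ g k e

infix 4 _≈[_]_

NoConstantTerm : ∀ {m} → Ser m → Set
NoConstantTerm f = ∀ e → f 0 e ≡ 0

module _ {m : ℕ} where

  ≈⇒≈[] : {f g : Ser m} (n : ℕ) → f ≈ g → f ≈[ n ] g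
  ≈⇒≈[] n f≈g k _ = f≈g k

  ⊗-cong-coeffwise : (f g f′ g′ : Ser m) (n : ℕ) (e : Exp m) →
    (∀ n₁ → n₁ ≤ n → ∀ e₁ e₂ → f n₁ e₁ * g (n ∸ n₁) e₂ ≡ f′ n₁ e₁ * g′ (n ∸ n₁) e₂) →
    (f ⊗ g) n e ≡ (f′ ⊗ g′) n e
  ⊗-cong-coeffwise f g f′ g′ n e termwise =
    trans (⊗-coeff f g n e)
      (trans (∑-cong-All (upTo (suc n)) (all-upTo (suc n))
                (λ n₁ n₁<1+n → ∑-cong (below e) (λ e₁ → termwise n₁ (≤-pred n₁<1+n) e₁ _)))
             (sym (⊗-coeff f′ g′ n e)))

  ⊗-cong-≈[] : {f g f′ g′ : Ser m} (n : ℕ) → f ≈[ n ] f′ → g ≈[ n ] g′ → f ⊗ g ≈[ n ] f′ ⊗ g′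
  ⊗-cong-≈[] {f} {g} {f′} {g′} n f≈f′ g≈g′ k k≤n e = ⊗-cong-coeffwise f g f′ g′ k e (λ n₁ n₁≤k e₁ e₂ →
    cong₂ _*_ (f≈f′ n₁ (≤-trans n₁≤k k≤n) e₁) (g≈g′ (k ∸ n₁) (≤-trans (m∸n≤m k n₁) k≤n) e₂))

  ⊗-cong : {f g f′ g′ : Ser m} → f ≈ f′ → g ≈ g′ → f ⊗ g ≈ f′ ⊗ g′
  ⊗-cong {f} {g} {f′} {g′} f≈f′ g≈g′ n =
    ⊗-cong-≈[] {f} {g} {f′} {g′} n (≈⇒≈[] n f≈f′) (≈⇒≈[] n g≈g′) n ≤-refl

  ⊗-congˡ : {f f′ : Ser m} (g : Ser m) → f ≈ f′ → f ⊗ g ≈ f′ ⊗ g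
  ⊗-congˡ g f≈f′ = ⊗-cong f≈f′ (≈-refl {f = g})

  ⊗-noConstantTermˡ : (f g : Ser m) → NoConstantTerm f → NoConstantTerm (f ⊗ g)
  ⊗-noConstantTermˡ f g f₀≡0 e =
    trans (⊗-coeff f g 0 e)
      (trans (+-identityʳ _)
        (trans (∑-cong (below e) (λ e₁ → cong (_* g 0 (zipWith _∸_ e e₁)) (f₀≡0 e₁))) (∑-zero (below e))))

  ⊗-cong-≈[suc] : {f g f′ g′ : Ser m} (n : ℕ) → NoConstantTerm f → NoConstantTerm f′ →
                  f ≈[ suc n ] f′ → g ≈[ n ] g′ → f ⊗ g ≈[ suc n ] f′ ⊗ g′
  ⊗-cong-≈[suc] {f} {g} {f′} {g′} n f₀≡0 f′₀≡0 f≈f′ g≈g′ k k≤1+n e =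
    ⊗-cong-coeffwise f g f′ g′ k e termwise
    where
    termwise : ∀ n₁ → n₁ ≤ k → ∀ e₁ e₂ → f n₁ e₁ * g (k ∸ n₁) e₂ ≡ f′ n₁ e₁ * g′ (k ∸ n₁) e₂
    termwise zero     _    e₁ e₂ rewrite f₀≡0 e₁ | f′₀≡0 e₁ = refl
    termwise (suc n₁) n₁<k e₁ e₂ =
      cong₂ _*_ (f≈f′ (suc n₁) (≤-trans n₁<k k≤1+n) e₁)
                (g≈g′ (k ∸ suc n₁) (≤-trans (∸-monoˡ-≤ (suc n₁) k≤1+n) (m∸n≤m n n₁)) e₂)

  ⊗-noConstantTerm³ : (X A B C : Ser m) → NoConstantTerm X → NoConstantTerm (X ⊗ A ⊗ B ⊗ C)
  ⊗-noConstantTerm³ X A B C X₀ =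
    ⊗-noConstantTermˡ (X ⊗ A ⊗ B) C (⊗-noConstantTermˡ (X ⊗ A) B (⊗-noConstantTermˡ X A X₀))

  noConstantTerm-≈[0] : {f g : Ser m} → NoConstantTerm f → NoConstantTerm g → f ≈[ 0 ] g
  noConstantTerm-≈[0] f₀≡0 g₀≡0 zero z≤n e = trans (f₀≡0 e) (sym (g₀≡0 e))

  ⊗³-cong-≈[suc] : {A B C A′ B′ C′ : Ser m} (X : Ser m) (n : ℕ) → NoConstantTerm X →
                   A ≈[ n ] A′ → B ≈[ n ] B′ → C ≈[ n ] C′ → X ⊗ A ⊗ B ⊗ C ≈[ suc n ] X ⊗ A′ ⊗ B′ ⊗ C′
  ⊗³-cong-≈[suc] {A} {B} {C} {A′} {B′} {C′} X n X₀ A≈A′ B≈B′ C≈C′ =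
    ⊗-cong-≈[suc] {f = X ⊗ A ⊗ B} {C} {X ⊗ A′ ⊗ B′} {C′} n
      (⊗-noConstantTermˡ (X ⊗ A) B XA₀) (⊗-noConstantTermˡ (X ⊗ A′) B′ XA′₀)
      (⊗-cong-≈[suc] {f = X ⊗ A} {B} {X ⊗ A′} {B′} n XA₀ XA′₀
        (⊗-cong-≈[suc] {f = X} {A} {X} {A′} n X₀ X₀ (λ _ _ _ → refl) A≈A′) B≈B′)
      C≈C′
    where
    XA₀ = ⊗-noConstantTermˡ X A X₀
    XA′₀ = ⊗-noConstantTermˡ X A′ X₀

  gf-⊗⁴ : (P A B C : List (Mon m)) (n : ℕ) (e : Exp m) →
    (gf P ⊗ gf A ⊗ gf B ⊗ gf C) n e ≡ ∑[ p ∈ P ] ∑[ a ∈ A ] ∑[ b ∈ B ] ∑[ c ∈ C ] ⟪ p · a · b · c ⟫ n e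
  gf-⊗⁴ P A B C n e = begin
    (gf P ⊗ gf A ⊗ gf B ⊗ gf C) n e
      ≡⟨ ⊗-congˡ (gf C) (⊗-congˡ (gf B) (gf-⊗ P A)) n e ⟩
    (gf (P ⋆ A) ⊗ gf B ⊗ gf C) n e
      ≡⟨ ⊗-congˡ (gf C) (gf-⊗ (P ⋆ A) B) n e ⟩
    (gf (P ⋆ A ⋆ B) ⊗ gf C) n e
      ≡⟨ gf-⊗ (P ⋆ A ⋆ B) C n e ⟩
    ∑ (P ⋆ A ⋆ B ⋆ C) (λ q → ⟪ q ⟫ n e)
      ≡⟨ ∑-⋆ (P ⋆ A ⋆ B) C _ ⟩
    ∑[ q ∈ P ⋆ A ⋆ B ] ∑[ c ∈ C ] ⟪ q · c ⟫ n e
      ≡⟨ ∑-⋆ (P ⋆ A) B _ ⟩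
    ∑[ q ∈ P ⋆ A ] ∑[ b ∈ B ] ∑[ c ∈ C ] ⟪ q · b · c ⟫ n e
      ≡⟨ ∑-⋆ P A _ ⟩
    ∑[ p ∈ P ] ∑[ a ∈ A ] ∑[ b ∈ B ] ∑[ c ∈ C ] ⟪ p · a · b · c ⟫ n e ∎

  gf-⊗-swap₂₃ : (P A B C : List (Mon m)) → gf P ⊗ gf A ⊗ gf B ⊗ gf C ≈ gf P ⊗ gf B ⊗ gf A ⊗ gf C
  gf-⊗-swap₂₃ P A B C n e = begin
    (gf P ⊗ gf A ⊗ gf B ⊗ gf C) n e
      ≡⟨ gf-⊗⁴ P A B C n e ⟩
    ∑[ p ∈ P ] ∑[ a ∈ A ] ∑[ b ∈ B ] ∑[ c ∈ C ] ⟪ p · a · b · c ⟫ n e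
      ≡⟨ ∑-cong P (λ p → ∑-comm A B (λ a b → ∑[ c ∈ C ] ⟪ p · a · b · c ⟫ n e)) ⟩
    ∑[ p ∈ P ] ∑[ b ∈ B ] ∑[ a ∈ A ] ∑[ c ∈ C ] ⟪ p · a · b · c ⟫ n e
      ≡⟨ ∑-cong P (λ p → ∑-cong B (λ b → ∑-cong A (λ a → ∑-cong C (λ c →
           cong (λ q → ⟪ q · c ⟫ n e) (·-swapʳ p a b))))) ⟩
    ∑[ p ∈ P ] ∑[ b ∈ B ] ∑[ a ∈ A ] ∑[ c ∈ C ] ⟪ p · b · a · c ⟫ n e
      ≡⟨ sym (gf-⊗⁴ P B A C n e) ⟩
    (gf P ⊗ gf B ⊗ gf A ⊗ gf C) n e ∎

∑-treesH-suc : ∀ h (f : Tree → ℕ) → ∑ (treesH (suc h)) f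
             ≡ f leaf + ∑[ x ∈ treesH h ] ∑[ y ∈ treesH h ] ∑[ w ∈ treesH h ] f (node x y w)
∑-treesH-suc h f = cong (f leaf +_) (begin
  ∑ (concatMap (λ x → concatMap (λ y → map (node x y) ts) ts) ts) f
    ≡⟨ ∑-concatMap (λ x → concatMap (λ y → map (node x y) ts) ts) ts f ⟩
  ∑[ x ∈ ts ] ∑ (concatMap (λ y → map (node x y) ts) ts) f
    ≡⟨ ∑-cong ts (λ x → ∑-concatMap (λ y → map (node x y) ts) ts f) ⟩
  ∑[ x ∈ ts ] ∑[ y ∈ ts ] ∑ (map (node x y) ts) f
    ≡⟨ ∑-cong ts (λ x → ∑-cong ts (λ y → ∑-map (node x y) ts f)) ⟩
  ∑[ x ∈ ts ] ∑[ y ∈ ts ] ∑[ w ∈ ts ] f (node x y w) ∎)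
  where ts = treesH h

∑-treesH-stable : ∀ h (f : Tree → ℕ) → (∀ B → h < size B → f B ≡ 0) →
                  ∑ (treesH (suc h)) f ≡ ∑ (treesH h) f
∑-treesH-stable zero    f f≡0 =
  trans (∑-treesH-suc 0 f) (cong (λ r → f leaf + (r + 0 + 0 + 0)) (f≡0 (node leaf leaf leaf) (s≤s z≤n)))
∑-treesH-stable (suc h) f f≡0 = begin
  ∑ (treesH (suc (suc h))) f
    ≡⟨ ∑-treesH-suc (suc h) f ⟩
  f leaf + ∑[ x ∈ T₁ ] ∑[ y ∈ T₁ ] ∑[ w ∈ T₁ ] f (node x y w)
    ≡⟨ cong (f leaf +_) (∑-treesH-stable h _ (λ x h<x → ∑∑-zero (λ y w → f≡0 _ (x-large h<x)))) ⟩
  f leaf + ∑[ x ∈ T₀ ] ∑[ y ∈ T₁ ] ∑[ w ∈ T₁ ] f (node x y w)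
    ≡⟨ cong (f leaf +_) (∑-cong T₀ (λ x → ∑-treesH-stable h _ (λ y h<y →
         trans (∑-cong T₁ (λ w → f≡0 _ (y-large x h<y))) (∑-zero T₁)))) ⟩
  f leaf + ∑[ x ∈ T₀ ] ∑[ y ∈ T₀ ] ∑[ w ∈ T₁ ] f (node x y w)
    ≡⟨ cong (f leaf +_) (∑-cong T₀ (λ x → ∑-cong T₀ (λ y → ∑-treesH-stable h _ (λ w h<w →
         f≡0 _ (w-large x y h<w))))) ⟩
  f leaf + ∑[ x ∈ T₀ ] ∑[ y ∈ T₀ ] ∑[ w ∈ T₀ ] f (node x y w)
    ≡⟨ sym (∑-treesH-suc h f) ⟩
  ∑ (treesH (suc h)) f ∎
  where
  T₁ = treesH (suc h)
  T₀ = treesH h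
  ∑∑-zero : {g : Tree → Tree → ℕ} → (∀ y w → g y w ≡ 0) → ∑[ y ∈ T₁ ] ∑[ w ∈ T₁ ] g y w ≡ 0
  ∑∑-zero g≡0 = trans (∑-cong T₁ (λ y → trans (∑-cong T₁ (g≡0 y)) (∑-zero T₁))) (∑-zero T₁)
  x-large : ∀ {x y w} → h < size x → suc h < size (node x y w)
  x-large {x} {y} {w} h<x = s≤s (≤-trans h<x (≤-trans (m≤m+n (size x) (size y)) (m≤m+n _ (size w))))
  y-large : ∀ x {y w} → h < size y → suc h < size (node x y w)
  y-large x {y} {w} h<y = s≤s (≤-trans h<y (≤-trans (m≤n+m (size y) (size x)) (m≤m+n _ (size w))))
  w-large : ∀ x y {w} → h < size w → suc h < size (node x y w)
  w-large x y {w} h<w = s≤s (≤-trans h<w (m≤n+m (size w) _))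

∑-treesH-≤ : ∀ h N (f : Tree → ℕ) → h ≤ N → (∀ B → h < size B → f B ≡ 0) →
             ∑ (treesH N) f ≡ ∑ (treesH h) f
∑-treesH-≤ h zero    f z≤n f≡0 = refl
∑-treesH-≤ h (suc N) f h≤1+N f≡0 with m≤n⇒m<n∨m≡n h≤1+N
... | inj₂ refl  = refl
... | inj₁ h<1+N =
  trans (∑-treesH-stable N f (λ B N<B → f≡0 B (≤-<-trans (≤-pred h<1+N) N<B)))
        (∑-treesH-≤ h N f (≤-pred h<1+N) f≡0)

+-cong₄ : ∀ {a b c d a′ b′ c′ d′ : ℕ} →
          a ≡ a′ → b ≡ b′ → c ≡ c′ → d ≡ d′ → a + b + c + d ≡ a′ + b′ + c′ + d′
+-cong₄ refl refl refl refl = refl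

+-swap₂₄ : ∀ a b c d → a + b + c + d ≡ a + d + c + b
+-swap₂₄ = solve-∀ℕ

cnt-translate : ∀ k j d ℓ B → cnt (k +ℤ d) (j +ℤ d) ℓ B ≡ cnt k j ℓ B
cnt-translate k j d ℓ leaf         = refl
cnt-translate k j d ℓ (node a b c) = +-cong₄
  (cong (λ i → ⟦ ∣ i ∣ ≡ᵇ ℓ ⟧) (difference-translate k j d))
  (trans (cong (λ i → cnt i (j +ℤ d) ℓ a) (pred-translate k d)) (cnt-translate (k -ℤ 1ℤ) j d ℓ a))
  (cnt-translate k j d ℓ b)
  (trans (cong (λ i → cnt i (j +ℤ d) ℓ c) (suc-translate k d)) (cnt-translate (k +ℤ 1ℤ) j d ℓ c))
  where
  difference-translate : ∀ k j d → (k +ℤ d) -ℤ (j +ℤ d) ≡ k -ℤ j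
  difference-translate = solve-∀
  pred-translate : ∀ k d → (k +ℤ d) -ℤ 1ℤ ≡ (k -ℤ 1ℤ) +ℤ d
  pred-translate = solve-∀
  suc-translate : ∀ k d → (k +ℤ d) +ℤ 1ℤ ≡ (k +ℤ 1ℤ) +ℤ d
  suc-translate = solve-∀

mirror : Tree → Tree
mirror leaf         = leaf
mirror (node a b c) = node (mirror c) (mirror b) (mirror a)

size-mirror : ∀ B → size (mirror B) ≡ size B
size-mirror leaf = refl
size-mirror (node a b c) rewrite size-mirror a | size-mirror b | size-mirror c =
  cong suc (+-swap₂₄ 0 (size c) (size b) (size a))

cnt-mirror : ∀ k j ℓ B → cnt k j ℓ (mirror B) ≡ cnt (- k) (- j) ℓ B
cnt-mirror k j ℓ leaf         = refl
cnt-mirror k j ℓ (node a b c) = trans (+-cong₄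
  (cong (λ i → ⟦ i ≡ᵇ ℓ ⟧) (trans (sym (ℤ.∣-i∣≡∣i∣ (k -ℤ j))) (cong ∣_∣ (negate-difference k j))))
  (trans (cnt-mirror (k -ℤ 1ℤ) j ℓ c) (cong (λ i → cnt i (- j) ℓ c) (negate-pred k)))
  (cnt-mirror k j ℓ b)
  (trans (cnt-mirror (k +ℤ 1ℤ) j ℓ a) (cong (λ i → cnt i (- j) ℓ a) (negate-suc k))))
  (+-swap₂₄ ⟦ ∣ (- k) -ℤ (- j) ∣ ≡ᵇ ℓ ⟧ (cnt ((- k) +ℤ 1ℤ) (- j) ℓ c) (cnt (- k) (- j) ℓ b)
            (cnt ((- k) -ℤ 1ℤ) (- j) ℓ a))
  where
  negate-difference : ∀ k j → - (k -ℤ j) ≡ (- k) -ℤ (- j)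
  negate-difference = solve-∀
  negate-pred : ∀ k → - (k -ℤ 1ℤ) ≡ (- k) +ℤ 1ℤ
  negate-pred = solve-∀
  negate-suc : ∀ k → - (k +ℤ 1ℤ) ≡ (- k) -ℤ 1ℤ
  negate-suc = solve-∀

∑-treesH-mirror : ∀ h (f : Tree → ℕ) → ∑ (treesH h) f ≡ ∑[ B ∈ treesH h ] f (mirror B)
∑-treesH-mirror zero    f = refl
∑-treesH-mirror (suc h) f = begin
  ∑ (treesH (suc h)) f
    ≡⟨ ∑-treesH-suc h f ⟩
  f leaf + ∑[ x ∈ ts ] ∑[ y ∈ ts ] ∑[ w ∈ ts ] f (node x y w)
    ≡⟨ cong (f leaf +_) (∑-reverse₃ ts (λ x y w → f (node x y w))) ⟩
  f leaf + ∑[ w ∈ ts ] ∑[ y ∈ ts ] ∑[ x ∈ ts ] f (node x y w)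
    ≡⟨ cong (f leaf +_) (∑-cong ts (λ w → ∑-cong ts (λ y → ∑-treesH-mirror h (λ x → f (node x y w))))) ⟩
  f leaf + ∑[ w ∈ ts ] ∑[ y ∈ ts ] ∑[ x ∈ ts ] f (node (mirror x) y w)
    ≡⟨ cong (f leaf +_) (∑-cong ts (λ w →
         ∑-treesH-mirror h (λ y → ∑[ x ∈ ts ] f (node (mirror x) y w)))) ⟩
  f leaf + ∑[ w ∈ ts ] ∑[ y ∈ ts ] ∑[ x ∈ ts ] f (node (mirror x) (mirror y) w)
    ≡⟨ cong (f leaf +_) (∑-treesH-mirror h (λ w →
         ∑[ y ∈ ts ] ∑[ x ∈ ts ] f (node (mirror x) (mirror y) w))) ⟩
  f leaf + ∑[ w ∈ ts ] ∑[ y ∈ ts ] ∑[ x ∈ ts ] f (node (mirror x) (mirror y) (mirror w))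
    ≡⟨ sym (∑-treesH-suc h (λ B → f (mirror B))) ⟩
  ∑[ B ∈ treesH (suc h) ] f (mirror B) ∎
  where ts = treesH h

weight : (m : ℕ) → ℤ → Tree → Mon m
weight m j B = size B , Nvec m j B

weight-mirror : ∀ m j B → weight m j (mirror B) ≡ weight m (- j) B
weight-mirror m j B = cong₂ _,_ (size-mirror B) (tabulate-cong (λ ℓ → cnt-mirror (⁺ 0) j (toℕ ℓ) B))

S-as-∑ : ∀ m j n e → S m j n e ≡ ∑[ B ∈ treesH n ] ⟪ weight m j B ⟫ n e
S-as-∑ m j n e = trans (length-filterᵇ _ (treesH n)) (∑-cong (treesH n) (λ B →
  cong₂ (λ a b → ⟦ a ∧ b ⟧) (≡ᵇ-sym (size B) n) (vecEqᵇ-sym (Nvec m j B) e)))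

S-symmetric : ∀ m j → S m j ≈ S m (- j)
S-symmetric m j n e = begin
  S m j n e                                      ≡⟨ S-as-∑ m j n e ⟩
  ∑[ B ∈ treesH n ] ⟪ weight m j B ⟫ n e          ≡⟨ ∑-treesH-mirror n _ ⟩
  ∑[ B ∈ treesH n ] ⟪ weight m j (mirror B) ⟫ n e ≡⟨ ∑-cong (treesH n) (λ B →
                                                       cong (λ a → ⟪ a ⟫ n e) (weight-mirror m j B)) ⟩
  ∑[ B ∈ treesH n ] ⟪ weight m (- j) B ⟫ n e      ≡⟨ sym (S-as-∑ m (- j) n e) ⟩
  S m (- j) n e                                  ∎

S≈[]gf : ∀ m j N → S m j ≈[ N ] gf (map (weight m j) (treesH N))
S≈[]gf m j N n n≤N e = begin
  S m j n e
    ≡⟨ S-as-∑ m j n e ⟩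
  ∑[ B ∈ treesH n ] ⟪ weight m j B ⟫ n e
    ≡⟨ sym (∑-treesH-≤ n N _ n≤N (λ B n<B →
         cong (λ b → ⟦ b ∧ vecEqᵇ e (Nvec m j B) ⟧) (≡ᵇ-false (<⇒≢ n<B)))) ⟩
  ∑[ B ∈ treesH N ] ⟪ weight m j B ⟫ n e
    ≡⟨ sym (∑-map (weight m j) (treesH N) (λ a → ⟪ a ⟫ n e)) ⟩
  gf (map (weight m j) (treesH N)) n e ∎

tabulate-zero : ∀ k → tabulate {n = k} (λ _ → 0) ≡ replicate k 0
tabulate-zero zero    = refl
tabulate-zero (suc k) = cong (0 ∷_) (tabulate-zero k)

tabulate-+ : ∀ {k} (f g : Fin k → ℕ) → tabulate (λ i → f i + g i) ≡ tabulate f +ᵛ tabulate g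
tabulate-+ {zero}  f g = refl
tabulate-+ {suc k} f g = cong (f zero + g zero ∷_) (tabulate-+ (λ i → f (suc i)) (λ i → g (suc i)))

rootExp : (m : ℕ) → ℤ → Exp m
rootExp m j = tabulate (λ ℓ → ⟦ ∣ ⁺ 0 -ℤ j ∣ ≡ᵇ toℕ ℓ ⟧)

N-node : ∀ j ℓ x y w →
  N j ℓ (node x y w) ≡ ⟦ ∣ ⁺ 0 -ℤ j ∣ ≡ᵇ ℓ ⟧ + N (j -ℤ 1ℤ) ℓ w + N j ℓ y + N (j +ℤ 1ℤ) ℓ x
N-node j ℓ x y w = trans
  (cong₂ (λ a d → ⟦ ∣ ⁺ 0 -ℤ j ∣ ≡ᵇ ℓ ⟧ + a + N j ℓ y + d)
         (sym (cnt-translate (⁺ 0 -ℤ 1ℤ) j 1ℤ ℓ x)) (sym (cnt-translate (⁺ 0 +ℤ 1ℤ) j (- 1ℤ) ℓ w)))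
  (+-swap₂₄ ⟦ ∣ ⁺ 0 -ℤ j ∣ ≡ᵇ ℓ ⟧ (N (j +ℤ 1ℤ) ℓ x) (N j ℓ y) (N (j -ℤ 1ℤ) ℓ w))

weight-node : ∀ m j x y w →
  weight m j (node x y w) ≡ (1 , rootExp m j) · weight m (j -ℤ 1ℤ) w · weight m j y · weight m (j +ℤ 1ℤ) x
weight-node m j x y w = cong₂ _,_ (+-swap₂₄ 1 (size x) (size y) (size w)) (begin
  tabulate (λ ℓ → N j (toℕ ℓ) (node x y w))
    ≡⟨ tabulate-cong (λ ℓ → N-node j (toℕ ℓ) x y w) ⟩
  tabulate (λ ℓ → R ℓ + A ℓ + B ℓ + C ℓ)
    ≡⟨ tabulate-+ (λ ℓ → R ℓ + A ℓ + B ℓ) C ⟩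
  tabulate (λ ℓ → R ℓ + A ℓ + B ℓ) +ᵛ tabulate C
    ≡⟨ cong (_+ᵛ tabulate C) (tabulate-+ (λ ℓ → R ℓ + A ℓ) B) ⟩
  tabulate (λ ℓ → R ℓ + A ℓ) +ᵛ tabulate B +ᵛ tabulate C
    ≡⟨ cong (λ v → v +ᵛ tabulate B +ᵛ tabulate C) (tabulate-+ R A) ⟩
  tabulate R +ᵛ tabulate A +ᵛ tabulate B +ᵛ tabulate C ∎)
  where
  R A B C : Fin (suc m) → ℕ
  R ℓ = ⟦ ∣ ⁺ 0 -ℤ j ∣ ≡ᵇ toℕ ℓ ⟧
  A ℓ = N (j -ℤ 1ℤ) (toℕ ℓ) w
  B ℓ = N j (toℕ ℓ) y
  C ℓ = N (j +ℤ 1ℤ) (toℕ ℓ) x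

Recursion : ∀ {m} → (ℤ → Ser m) → ℤ → Ser m → Set
Recursion T j X = T j ≈ one ⊕ X ⊗ T (j -ℤ 1ℤ) ⊗ T j ⊗ T (j +ℤ 1ℤ)

Recursion-cong : ∀ {m} {T : ℤ → Ser m} {j X X′} → X ≈ X′ → Recursion T j X → Recursion T j X′
Recursion-cong {T = T} {j} X≈X′ rec n e =
  trans (rec n e) (cong (one n e +_)
    (⊗-congˡ (T (j +ℤ 1ℤ)) (⊗-congˡ (T j) (⊗-congˡ (T (j -ℤ 1ℤ)) X≈X′)) n e))

S-recursion : ∀ m j → Recursion (S m) j ⟪ 1 , rootExp m j ⟫
S-recursion m j n e = begin
  S m j n e
    ≡⟨ S≈[]gf m j (suc n) n (n≤1+n n) e ⟩
  gf (map (weight m j) (treesH (suc n))) n e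
    ≡⟨ ∑-map (weight m j) (treesH (suc n)) (λ a → ⟪ a ⟫ n e) ⟩
  ∑[ B ∈ treesH (suc n) ] ⟪ weight m j B ⟫ n e
    ≡⟨ ∑-treesH-suc n (λ B → ⟪ weight m j B ⟫ n e) ⟩
  ⟪ weight m j leaf ⟫ n e + ∑[ x ∈ ts ] ∑[ y ∈ ts ] ∑[ w ∈ ts ] ⟪ weight m j (node x y w) ⟫ n e
    ≡⟨ cong₂ _+_ (cong (λ v → mono 0 v n e) (tabulate-zero (suc m))) (∑-reverse₃ ts _) ⟩
  one n e + ∑[ w ∈ ts ] ∑[ y ∈ ts ] ∑[ x ∈ ts ] ⟪ weight m j (node x y w) ⟫ n e
    ≡⟨ cong (one n e +_) (∑-cong ts (λ w → ∑-cong ts (λ y → ∑-cong ts (λ x →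
         cong (λ a → ⟪ a ⟫ n e) (weight-node m j x y w))))) ⟩
  one n e + ∑[ w ∈ ts ] ∑[ y ∈ ts ] ∑[ x ∈ ts ] ⟪ r · wt (j -ℤ 1ℤ) w · wt j y · wt (j +ℤ 1ℤ) x ⟫ n e
    ≡⟨ cong (one n e +_) (sym products) ⟩
  (one ⊕ ⟪ r ⟫ ⊗ S m (j -ℤ 1ℤ) ⊗ S m j ⊗ S m (j +ℤ 1ℤ)) n e ∎
  where
  ts = treesH n
  r = (1 , rootExp m j)
  wt = weight m
  W : ℤ → List (Mon m)
  W i = map (wt i) ts
  products : (⟪ r ⟫ ⊗ S m (j -ℤ 1ℤ) ⊗ S m j ⊗ S m (j +ℤ 1ℤ)) n e
           ≡ ∑[ w ∈ ts ] ∑[ y ∈ ts ] ∑[ x ∈ ts ] ⟪ r · wt (j -ℤ 1ℤ) w · wt j y · wt (j +ℤ 1ℤ) x ⟫ n e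
  products = begin
    (⟪ r ⟫ ⊗ S m (j -ℤ 1ℤ) ⊗ S m j ⊗ S m (j +ℤ 1ℤ)) n e
      ≡⟨ ⊗-cong-≈[] n (⊗-cong-≈[] n (⊗-cong-≈[] n (≈⇒≈[] n (mono≈gf r)) (S≈[]gf m (j -ℤ 1ℤ) n))
           (S≈[]gf m j n)) (S≈[]gf m (j +ℤ 1ℤ) n) n ≤-refl e ⟩
    (gf (r ∷ []) ⊗ gf (W (j -ℤ 1ℤ)) ⊗ gf (W j) ⊗ gf (W (j +ℤ 1ℤ))) n e
      ≡⟨ trans (gf-⊗⁴ (r ∷ []) (W (j -ℤ 1ℤ)) (W j) (W (j +ℤ 1ℤ)) n e) (+-identityʳ _) ⟩
    ∑[ a ∈ W (j -ℤ 1ℤ) ] ∑[ b ∈ W j ] ∑[ c ∈ W (j +ℤ 1ℤ) ] ⟪ r · a · b · c ⟫ n e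
      ≡⟨ trans (∑-map (wt (j -ℤ 1ℤ)) ts _) (∑-cong ts (λ w →
           trans (∑-map (wt j) ts _) (∑-cong ts (λ y → ∑-map (wt (j +ℤ 1ℤ)) ts _)))) ⟩
    ∑[ w ∈ ts ] ∑[ y ∈ ts ] ∑[ x ∈ ts ] ⟪ r · wt (j -ℤ 1ℤ) w · wt j y · wt (j +ℤ 1ℤ) x ⟫ n e ∎

∣0-p∣≡p : ∀ p → ∣ ⁺ 0 -ℤ ⁺ p ∣ ≡ p
∣0-p∣≡p p = trans (cong ∣_∣ (ℤ.+-identityˡ (- ⁺ p))) (ℤ.∣-i∣≡∣i∣ (⁺ p))

rootExp-+ : ∀ m p → rootExp m (⁺ p) ≡ tabulate (λ ℓ → ⟦ p ≡ᵇ toℕ ℓ ⟧)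
rootExp-+ m p = tabulate-cong (λ ℓ → cong (λ q → ⟦ q ≡ᵇ toℕ ℓ ⟧) (∣0-p∣≡p p))

rootExp-far : ∀ {m p} → m < p → rootExp m (⁺ p) ≡ replicate (suc m) 0
rootExp-far {m} {p} m<p = trans (rootExp-+ m p) (trans
  (tabulate-cong (λ ℓ → cong ⟦_⟧ (≡ᵇ-false (λ p≡ℓ → <-irrefl (sym p≡ℓ) (<-≤-trans (toℕ<n ℓ) m<p)))))
  (tabulate-zero (suc m)))

tabulate-toℕ-≡ᵇ : ∀ {k} (f : Fin k) → tabulate (λ ℓ → ⟦ toℕ f ≡ᵇ toℕ ℓ ⟧) ≡ replicate k 0 [ f ]≔ 1
tabulate-toℕ-≡ᵇ {suc k} zero    = cong (1 ∷_) (tabulate-zero k)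
tabulate-toℕ-≡ᵇ {suc k} (suc f) = cong (0 ∷_) (tabulate-toℕ-≡ᵇ f)

z≈root : ∀ {m p} → m < p → z ≈ ⟪ 1 , rootExp m (⁺ p) ⟫
z≈root m<p n e = cong (λ v → mono 1 v n e) (sym (rootExp-far m<p))

u⊗z≈root : ∀ {m} (f : Fin (suc m)) → u f ⊗ z ≈ ⟪ 1 , rootExp m (⁺ toℕ f) ⟫
u⊗z≈root {m} f n e = trans (mono-⊗ (0 , replicate (suc m) 0 [ f ]≔ 1) (1 , replicate (suc m) 0) n e)
  (cong (λ v → mono 1 v n e) (begin
    (replicate (suc m) 0 [ f ]≔ 1) +ᵛ replicate (suc m) 0 ≡⟨ zipWith-identityʳ +-identityʳ _ ⟩
    replicate (suc m) 0 [ f ]≔ 1                         ≡⟨ sym (tabulate-toℕ-≡ᵇ f) ⟩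
    tabulate (λ ℓ → ⟦ toℕ f ≡ᵇ toℕ ℓ ⟧)                  ≡⟨ sym (rootExp-+ m (toℕ f)) ⟩
    rootExp m (⁺ toℕ f)                                  ∎))

S-system : ∀ m → System m (S m)
S-system m =
    S-symmetric m
  , (λ p m<p → Recursion-cong {T = S m} {⁺ p} (≈-sym (z≈root m<p)) (S-recursion m (⁺ p)))
  , (λ f → Recursion-cong {T = S m} {⁺ toℕ f} (≈-sym (u⊗z≈root f)) (S-recursion m (⁺ toℕ f)))

S-⊗-swap₂₃ : ∀ m (X : Ser m) (P : List (Mon m)) → X ≈ gf P → ∀ i j k →
             X ⊗ S m i ⊗ S m j ⊗ S m k ≈ X ⊗ S m j ⊗ S m i ⊗ S m k
S-⊗-swap₂₃ m X P X≈P i j k n e = begin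
  (X ⊗ S m i ⊗ S m j ⊗ S m k) n e               ≡⟨ approx i j ⟩
  (gf P ⊗ gf (W i) ⊗ gf (W j) ⊗ gf (W k)) n e ≡⟨ gf-⊗-swap₂₃ P (W i) (W j) (W k) n e ⟩
  (gf P ⊗ gf (W j) ⊗ gf (W i) ⊗ gf (W k)) n e ≡⟨ sym (approx j i) ⟩
  (X ⊗ S m j ⊗ S m i ⊗ S m k) n e               ∎
  where
  W : ℤ → List (Mon m)
  W a = map (weight m a) (treesH n)
  approx : ∀ a b → (X ⊗ S m a ⊗ S m b ⊗ S m k) n e ≡ (gf P ⊗ gf (W a) ⊗ gf (W b) ⊗ gf (W k)) n e
  approx a b = ⊗-cong-≈[] n (⊗-cong-≈[] n (⊗-cong-≈[] n (≈⇒≈[] n X≈P) (S≈[]gf m a n)) (S≈[]gf m b n))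
                 (S≈[]gf m k n) n ≤-refl e

S₀-recursion : ∀ m → S m (⁺ 0) ≈ one ⊕ u zero ⊗ z ⊗ S m (⁺ 0) ⊗ S m (⁺ 1) ⊗ S m (⁺ 1)
S₀-recursion m n e = begin
  S m (⁺ 0) n e
    ≡⟨ proj₂ (proj₂ (S-system m)) zero n e ⟩
  (one ⊕ X ⊗ S m -[1+ 0 ] ⊗ S m (⁺ 0) ⊗ S m (⁺ 1)) n e
    ≡⟨ cong (one n e +_) (⊗-congˡ (S m (⁺ 1)) (⊗-congˡ (S m (⁺ 0))
         (⊗-cong (≈-refl {f = X}) (S-symmetric m -[1+ 0 ]))) n e) ⟩
  (one ⊕ X ⊗ S m (⁺ 1) ⊗ S m (⁺ 0) ⊗ S m (⁺ 1)) n e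
    ≡⟨ cong (one n e +_) (S-⊗-swap₂₃ m X (r ∷ []) X≈gf (⁺ 1) (⁺ 0) (⁺ 1) n e) ⟩
  (one ⊕ X ⊗ S m (⁺ 0) ⊗ S m (⁺ 1) ⊗ S m (⁺ 1)) n e ∎
  where
  X = u zero ⊗ z
  r = (1 , rootExp m (⁺ 0))
  X≈gf : X ≈ gf (r ∷ [])
  X≈gf = ≈-trans {g = ⟪ r ⟫} (u⊗z≈root zero) (mono≈gf r)

System⇒Recursion : ∀ {m} {T : ℤ → Ser m} → System m T → ∀ p → Recursion T (⁺ p) ⟪ 1 , rootExp m (⁺ p) ⟫
System⇒Recursion {m} {T} (_ , far , near) p with p ≤? m
... | no p≰m  = Recursion-cong {T = T} {⁺ p} (z≈root (≰⇒> p≰m)) (far p (≰⇒> p≰m))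
... | yes p≤m = subst (λ q → Recursion T (⁺ q) ⟪ 1 , rootExp m (⁺ q) ⟫) (toℕ-fromℕ< (s≤s p≤m))
                      (Recursion-cong {T = T} {⁺ toℕ f} (u⊗z≈root f) (near f))
  where f = fromℕ< (s≤s p≤m)

module _ {m : ℕ} {T T′ : ℤ → Ser m} (sys : System m T) (sys′ : System m T′) where

  private
    root : ℕ → Ser m
    root p = ⟪ 1 , rootExp m (⁺ p) ⟫

    Rhs : (ℤ → Ser m) → ℕ → Ser m
    Rhs U p = root p ⊗ U (⁺ p -ℤ 1ℤ) ⊗ U (⁺ p) ⊗ U (⁺ p +ℤ 1ℤ)

    Rhs-noConstantTerm : ∀ U p → NoConstantTerm (Rhs U p)
    Rhs-noConstantTerm U p =
      ⊗-noConstantTerm³ (root p) (U (⁺ p -ℤ 1ℤ)) (U (⁺ p)) (U (⁺ p +ℤ 1ℤ)) (λ e → refl)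

    agree-from-Rhs : ∀ n → (∀ p → Rhs T p ≈[ n ] Rhs T′ p) → ∀ j → T j ≈[ n ] T′ j
    agree-from-Rhs n Rhs≈ (⁺ p) k k≤n e =
      trans (System⇒Recursion sys p k e)
        (trans (cong (one k e +_) (Rhs≈ p k k≤n e)) (sym (System⇒Recursion sys′ p k e)))
    agree-from-Rhs n Rhs≈ -[1+ p ] k k≤n e =
      trans (proj₁ sys -[1+ p ] k e)
        (trans (agree-from-Rhs n Rhs≈ (⁺ suc p) k k≤n e) (sym (proj₁ sys′ -[1+ p ] k e)))

    agree-up-to : ∀ n j → T j ≈[ n ] T′ j
    agree-up-to zero    = agree-from-Rhs 0 (λ p →
      noConstantTerm-≈[0] (Rhs-noConstantTerm T p) (Rhs-noConstantTerm T′ p))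
    agree-up-to (suc n) = agree-from-Rhs (suc n) (λ p →
      ⊗³-cong-≈[suc] (root p) n (λ e → refl) (agree-up-to n _) (agree-up-to n _) (agree-up-to n _))

  System-unique : ∀ j → T j ≈ T′ j
  System-unique j n = agree-up-to n j n ≤-refl

-- Imported only here: the prefix constructor +_ makes sections such as (a +_) ambiguous.
open import Data.Integer using (+_)

lemma4 : (m : ℕ) →
    System m (S m) ×
    (S m (+ 0) ≈ one ⊕ u zero ⊗ z ⊗ S m (+ 0) ⊗ S m (+ 1) ⊗ S m (+ 1)) ×
    (∀ (T : ℤ → Ser m) → System m T → ∀ (j : ℤ) → T j ≈ S m j)
lemma4 m = S-system m , S₀-recursion m , λ T sys → System-unique sys (S-system m)
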